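{- Let $\mathcal{L}$ be a finite set of $L$ loads and $\mathcal{A}\subseteq2^{\mathcal{L}}$ a family such that every load belongs to some $A\in\mathcal{A}$. With $\mathcal{B}:\mathbb{R}_+^L\to\mathbb{R}_+$ defined as in the context, for all $d\in\mathbb{R}_+^L$, $$\mathcal{B}\Big(\frac d2\Big)=\mathbb{E}_{X\sim d}\Big[\mathcal{B}\Big(\frac X2\Big)\Big],$$ where $X\sim d$ denotes the random vector $X=\lfloor d\rfloor+Z$ with $Z$ having independent coordinates $Z_i\sim\mathrm{Bernoulli}(d_i-\lfloor d_i\rfloor)$.
   Context: For $X\in\mathbb{Z}_+^L$, $\mathcal{B}(X):=\min\{\sum_{A\in\mathcal{A}}x_A:\sum_{A\ni i}x_A\ge X_i\ \forall i,\ x_A\in\mathbb{Z}_+\}$; for $d\in\mathbb{R}_+^L$, $\mathcal{B}(d):=\mathbb{E}[\mathcal{B}(\lfloor d\rfloor+Z)]$ where $\lfloor d\rfloor$ is coordinatewise and $Z$ has independent coordinates $Z_i\sim\mathrm{Bernoulli}(d_i-\lfloor d_i\rfloor)$. In particular $\mathcal{B}(X/2)$ for $X\in\mathbb{Z}_+^L$ is evaluated via this extension. -}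

module Defs where

open import Level using (Level; _⊔_) renaming (suc to lsuc)
open import Data.Nat as ℕ using (ℕ; zero; suc)
open import Data.Fin using (Fin; zero; suc)
open import Data.Bool using (Bool; true; false; if_then_else_)
open import Data.Product using (Σ; ∃; _×_; _,_)
open import Data.Sum using (_⊎_)
open import Relation.Nullary using (¬_)
open import Relation.Binary.PropositionalEquality using (_≡_)
open import Algebra.Bundles using (CommutativeRing)

-- We state the result uniformly for
-- every ordered field equipped with a floor function on the nonnegative
-- elements (ℝ is such a structure, so the statement covers ℝ).

ιR : ∀ {c ℓ} (R : CommutativeRing c ℓ) → ℕ → CommutativeRing.Carrier R
ιR R zero    = CommutativeRing.0# R
ιR R (suc n) = CommutativeRing._+_ R (CommutativeRing.1# R) (ιR R n)

record OrderedFieldWithFloor (c ℓ ℓ' : Level) : Set (lsuc (c ⊔ ℓ ⊔ ℓ')) where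
  field
    cring : CommutativeRing c ℓ
  open CommutativeRing cring public hiding (ring; zero)
  field
    _≤_       : Carrier → Carrier → Set ℓ'
    ≤-resp-≈  : ∀ {x x' y y'} → x ≈ x' → y ≈ y' → x ≤ y → x' ≤ y'
    ≤-refl    : ∀ {x} → x ≤ x
    ≤-trans   : ∀ {x y z} → x ≤ y → y ≤ z → x ≤ z
    ≤-antisym : ∀ {x y} → x ≤ y → y ≤ x → x ≈ y
    ≤-total   : ∀ x y → x ≤ y ⊎ y ≤ x
    +-mono-≤  : ∀ {x y} z → x ≤ y → (x + z) ≤ (y + z)
    *-nonneg  : ∀ {x y} → 0# ≤ x → 0# ≤ y → 0# ≤ (x * y)
    1≉0       : ¬ (1# ≈ 0#)
    _⁻¹       : Carrier → Carrier
    inverse   : ∀ x → ¬ (x ≈ 0#) → (x * (x ⁻¹)) ≈ 1#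
    ⌊_⌋       : Carrier → ℕ
    floor-≤ : ∀ x → 0# ≤ x → ιR cring ⌊ x ⌋ ≤ x
    floor-< : ∀ x → 0# ≤ x → ¬ ((ιR cring ⌊ x ⌋ + 1#) ≤ x)
  ι : ℕ → Carrier
  ι = ιR cring

module _ {c ℓ} (R : CommutativeRing c ℓ) where
  open CommutativeRing R using (Carrier; _+_; _*_; 1#)

  sumSubsets : (n : ℕ) → ((Fin n → Bool) → Carrier) → Carrier
  sumSubsets zero    f = f (λ ())
  sumSubsets (suc n) f =
    sumSubsets n (λ s → f (cons true s)) + sumSubsets n (λ s → f (cons false s))
    where
    cons : Bool → (Fin n → Bool) → Fin (suc n) → Bool
    cons b s zero    = b
    cons b s (suc i) = s i

  prodFin : (n : ℕ) → (Fin n → Carrier) → Carrier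
  prodFin zero    f = 1#
  prodFin (suc n) f = f zero * prodFin n (λ i → f (suc i))

sumℕ : (m : ℕ) → (Fin m → ℕ) → ℕ
sumℕ zero    f = 0
sumℕ (suc m) f = f zero ℕ.+ sumℕ m (λ a → f (suc a))

-- The covering integer program.  Loads are Fin L; the family 𝒜 ⊆ 2^ℒ is
-- given as an indexed family 𝒜 : Fin m → (Fin L → Bool) of subsets.

Covers : {L m : ℕ} → (Fin m → Fin L → Bool) → Set
Covers {L} {m} 𝒜 = ∀ (i : Fin L) → ∃ λ (a : Fin m) → 𝒜 a i ≡ true

load : {L m : ℕ} → (Fin m → Fin L → Bool) → (Fin m → ℕ) → Fin L → ℕ
load {L} {m} 𝒜 x i = sumℕ m (λ a → if 𝒜 a i then x a else 0)

Feasible : {L m : ℕ} → (Fin m → Fin L → Bool) → (Fin L → ℕ) → (Fin m → ℕ) → Set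
Feasible 𝒜 X x = ∀ i → X i ℕ.≤ load 𝒜 x i

cost : {m : ℕ} → (Fin m → ℕ) → ℕ
cost {m} x = sumℕ m x

IsOptValue : {L m : ℕ} → (Fin m → Fin L → Bool) → (Fin L → ℕ) → ℕ → Set
IsOptValue 𝒜 X b =
  (∃ λ x → Feasible 𝒜 X x × cost x ≡ b) × (∀ x → Feasible 𝒜 X x → b ℕ.≤ cost x)

-- Randomized extension ℬ(d) = E[ℬ(⌊d⌋ + Z)], Z_i ~ Bernoulli(d_i - ⌊d_i⌋)
-- independent, and the expectation E_{X∼d}[g(X)].

module Extension {c ℓ ℓ'} (F : OrderedFieldWithFloor c ℓ ℓ') where
  open OrderedFieldWithFloor F

  frac : Carrier → Carrier
  frac x = x - ι ⌊ x ⌋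

  roundUp : {L : ℕ} → (Fin L → Carrier) → (Fin L → Bool) → Fin L → ℕ
  roundUp d S i = ⌊ d i ⌋ ℕ.+ (if S i then 1 else 0)

  prob : {L : ℕ} → (Fin L → Carrier) → (Fin L → Bool) → Carrier
  prob {L} d S = prodFin cring L (λ i → if S i then frac (d i) else (1# - frac (d i)))

  Exp : {L : ℕ} → (Fin L → Carrier) → ((Fin L → ℕ) → Carrier) → Carrier
  Exp {L} d g = sumSubsets cring L (λ S → prob d S * g (roundUp d S))

  Bext : {L : ℕ} → ((Fin L → ℕ) → ℕ) → (Fin L → Carrier) → Carrier
  Bext B d = Exp d (λ X → ι (B X))

  half : Carrier
  half = (1# + 1#) ⁻¹

{-# OPTIONS --safe #-}
module Submission where

-- Both sides are expectations over independent coordinates, so they can be computed one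
-- coordinate at a time, and by a Fubini argument for products of two-point distributions
-- the identity reduces to a single coordinate x ≥ 0: rounding x randomly to X ∈ {⌊x⌋, ⌊x⌋+1}
-- and then rounding X/2 randomly gives the same distribution as rounding x/2 directly.
-- Writing ⌊x⌋ = 2m or 2m+1, both procedures land in {m, m+1}, and the two-stage one reaches
-- m+1 with probability frac(x)/2, respectively 1/2 + frac(x)/2, which is frac(x/2) in either
-- case.  Of ℬ only the fact that ℬ(X) depends on the values of X alone is used.

open import Defs
open import Data.Nat as ℕ using (ℕ; zero; suc)
import Data.Nat.Properties as ℕ
open import Data.Fin using (Fin; zero; suc)
open import Data.Bool using (Bool)
open import Data.Vec.Functional using ([]; _∷_; head; tail)
open import Data.Product using (∃-syntax; _,_)
open import Data.Sum using (_⊎_; inj₁; inj₂)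
open import Data.Empty using (⊥-elim)
open import Function using (_∘_)
open import Relation.Nullary using (¬_)
open import Relation.Binary.Definitions using (tri<; tri≈; tri>)
open import Relation.Binary.PropositionalEquality as ≡ using (_≡_; _≗_)
open import Algebra.Bundles using (CommutativeRing)

Feasible-resp-≗ : ∀ {L m} {𝒜 : Fin m → Fin L → Bool} {X Y x} →
  X ≗ Y → Feasible 𝒜 X x → Feasible 𝒜 Y x
Feasible-resp-≗ X≗Y feasible i = ≡.subst (ℕ._≤ _) (X≗Y i) (feasible i)

IsOptValue-unique : ∀ {L m} {𝒜 : Fin m → Fin L → Bool} {X Y b b′} →
  X ≗ Y → IsOptValue 𝒜 X b → IsOptValue 𝒜 Y b′ → b ≡ b′
IsOptValue-unique {𝒜 = 𝒜} X≗Y ((x , x-feas , x-cost) , b-min) ((y , y-feas , y-cost) , b′-min) =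
  ℕ.≤-antisym
    (≡.subst (_ ℕ.≤_) y-cost (b-min y (Feasible-resp-≗ {𝒜 = 𝒜} (≡.sym ∘ X≗Y) y-feas)))
    (≡.subst (_ ℕ.≤_) x-cost (b′-min x (Feasible-resp-≗ {𝒜 = 𝒜} X≗Y x-feas)))

even-or-odd : ∀ n → (∃[ m ] n ≡ m ℕ.+ m) ⊎ (∃[ m ] n ≡ suc (m ℕ.+ m))
even-or-odd zero = inj₁ (0 , ≡.refl)
even-or-odd (suc n) with even-or-odd n
... | inj₁ (m , n≡m+m)   = inj₂ (m , ≡.cong suc n≡m+m)
... | inj₂ (m , n≡1+m+m) = inj₁ (suc m , ≡.cong suc (≡.trans n≡1+m+m (≡.sym (ℕ.+-suc m m))))

module CommutativeRingLemmas {c ℓ} (R : CommutativeRing c ℓ) where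
  open CommutativeRing R
  open import Algebra.Properties.AbelianGroup +-abelianGroup using (xyx⁻¹≈y; ⁻¹-∙-comm)
  open import Algebra.Properties.CommutativeSemigroup +-commutativeSemigroup using (interchange)

  x+[y-x]≈y : ∀ x y → x + (y - x) ≈ y
  x+[y-x]≈y x y = trans (sym (+-assoc x y (- x))) (xyx⁻¹≈y x y)

  [x-y]+[z-w]≈[x+z]-[y+w] : ∀ x y z w → (x - y) + (z - w) ≈ (x + z) - (y + w)
  [x-y]+[z-w]≈[x+z]-[y+w] x y z w = trans (interchange x (- y) z (- w)) (+-congˡ (⁻¹-∙-comm y w))

  sumSubsets-cong : ∀ n {f g} → (∀ s → f s ≈ g s) → sumSubsets R n f ≈ sumSubsets R n g
  sumSubsets-cong zero    f≈g = f≈g _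
  sumSubsets-cong (suc n) f≈g =
    +-cong (sumSubsets-cong n (f≈g ∘ _)) (sumSubsets-cong n (f≈g ∘ _))

  *-distribˡ-sumSubsets : ∀ n a f → a * sumSubsets R n f ≈ sumSubsets R n (λ s → a * f s)
  *-distribˡ-sumSubsets zero    a f = refl
  *-distribˡ-sumSubsets (suc n) a f =
    trans (distribˡ a _ _) (+-cong (*-distribˡ-sumSubsets n a _) (*-distribˡ-sumSubsets n a _))

module OrderedFieldProperties {c ℓ ℓ'} (F : OrderedFieldWithFloor c ℓ ℓ') where
  open OrderedFieldWithFloor F
  open Extension F
  open import Algebra.Properties.Ring (CommutativeRing.ring cring)
    using (-‿distribˡ-*; -‿distribʳ-*; [y-z]x≈yx-zx)
  open import Algebra.Properties.Group +-group using (⁻¹-involutive)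
  open import Relation.Binary.Reasoning.Setoid setoid

  x≤y⇒0≤y-x : ∀ {x y} → x ≤ y → 0# ≤ (y - x)
  x≤y⇒0≤y-x {x} x≤y = ≤-resp-≈ (-‿inverseʳ x) refl (+-mono-≤ (- x) x≤y)

  0≤y-x⇒x≤y : ∀ {x y} → 0# ≤ (y - x) → x ≤ y
  0≤y-x⇒x≤y {x} {y} 0≤y-x = ≤-resp-≈ (+-identityˡ x) y-x+x≈y (+-mono-≤ x 0≤y-x)
    where
    y-x+x≈y : y - x + x ≈ y
    y-x+x≈y = trans (+-assoc y (- x) x) (trans (+-congˡ (-‿inverseˡ x)) (+-identityʳ y))

  +-mono₂-≤ : ∀ {a b c d} → a ≤ b → c ≤ d → (a + c) ≤ (b + d)
  +-mono₂-≤ {a} {b} {c} {d} a≤b c≤d =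
    ≤-trans (+-mono-≤ c a≤b) (≤-resp-≈ (+-comm c b) (+-comm d b) (+-mono-≤ b c≤d))

  +-nonneg : ∀ {a b} → 0# ≤ a → 0# ≤ b → 0# ≤ (a + b)
  +-nonneg 0≤a 0≤b = ≤-resp-≈ (+-identityˡ 0#) refl (+-mono₂-≤ 0≤a 0≤b)

  *-monoˡ-≤-nonneg : ∀ {x y z} → 0# ≤ z → x ≤ y → (x * z) ≤ (y * z)
  *-monoˡ-≤-nonneg {x} {y} {z} 0≤z x≤y =
    0≤y-x⇒x≤y (≤-resp-≈ refl ([y-z]x≈yx-zx z y x) (*-nonneg (x≤y⇒0≤y-x x≤y) 0≤z))

  x*x-nonneg : ∀ x → 0# ≤ (x * x)
  x*x-nonneg x with ≤-total 0# x
  ... | inj₁ 0≤x = *-nonneg 0≤x 0≤x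
  ... | inj₂ x≤0 = ≤-resp-≈ refl -x*-x≈x*x (*-nonneg 0≤-x 0≤-x)
    where
    0≤-x : 0# ≤ (- x)
    0≤-x = ≤-resp-≈ refl (+-identityˡ (- x)) (x≤y⇒0≤y-x x≤0)
    -x*-x≈x*x : - x * - x ≈ x * x
    -x*-x≈x*x = begin
      - x * - x     ≈⟨ -‿distribˡ-* x (- x) ⟨
      - (x * - x)   ≈⟨ -‿cong (-‿distribʳ-* x x) ⟨
      - (- (x * x)) ≈⟨ ⁻¹-involutive (x * x) ⟩
      x * x         ∎

  0≤1 : 0# ≤ 1#
  0≤1 = ≤-resp-≈ refl (*-identityˡ 1#) (x*x-nonneg 1#)

  1≰0 : ¬ (1# ≤ 0#)
  1≰0 1≤0 = 1≉0 (≤-antisym 1≤0 0≤1)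

  half+half≈1 : half + half ≈ 1#
  half+half≈1 = begin
    half + half           ≈⟨ +-cong (*-identityˡ half) (*-identityˡ half) ⟨
    1# * half + 1# * half ≈⟨ distribʳ half 1# 1# ⟨
    (1# + 1#) * half      ≈⟨ inverse (1# + 1#) 1+1≉0 ⟩
    1#                    ∎
    where
    1+1≉0 : ¬ (1# + 1# ≈ 0#)
    1+1≉0 1+1≈0 = 1≰0 (≤-resp-≈ (+-identityˡ 1#) 1+1≈0 (+-mono-≤ 1# 0≤1))

  x*half+x*half≈x : ∀ x → x * half + x * half ≈ x
  x*half+x*half≈x x =
    trans (sym (distribˡ x half half)) (trans (*-congˡ half+half≈1) (*-identityʳ x))

  [x+x]*half≈x : ∀ x → (x + x) * half ≈ x
  [x+x]*half≈x x = trans (distribʳ half x x) (x*half+x*half≈x x)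

  half-nonneg : 0# ≤ half
  half-nonneg = ≤-resp-≈ refl (x*half+x*half≈x half) (+-nonneg (x*x-nonneg half) (x*x-nonneg half))

  ι-+ : ∀ m n → ι (m ℕ.+ n) ≈ ι m + ι n
  ι-+ zero    n = sym (+-identityˡ (ι n))
  ι-+ (suc m) n = trans (+-congˡ (ι-+ m n)) (sym (+-assoc 1# (ι m) (ι n)))

  ι-nonneg : ∀ n → 0# ≤ ι n
  ι-nonneg zero    = ≤-refl
  ι-nonneg (suc n) = +-nonneg 0≤1 (ι-nonneg n)

  ι-mono : ∀ {m n} → m ℕ.≤ n → ι m ≤ ι n
  ι-mono {n = n} ℕ.z≤n = ι-nonneg n
  ι-mono (ℕ.s≤s m≤n)   = +-mono₂-≤ ≤-refl (ι-mono m≤n)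

  ι[1+⌊x⌋]≰x : ∀ x → 0# ≤ x → ¬ (ι (suc ⌊ x ⌋) ≤ x)
  ι[1+⌊x⌋]≰x x 0≤x = floor-< x 0≤x ∘ ≤-resp-≈ (+-comm 1# (ι ⌊ x ⌋)) refl

  ⌊⌋-unique : ∀ {x n} → 0# ≤ x → ι n ≤ x → ¬ (ι (suc n) ≤ x) → ⌊ x ⌋ ≡ n
  ⌊⌋-unique {x} {n} 0≤x ιn≤x ι[1+n]≰x with ℕ.<-cmp ⌊ x ⌋ n
  ... | tri< ⌊x⌋<n _ _ = ⊥-elim (ι[1+⌊x⌋]≰x x 0≤x (≤-trans (ι-mono ⌊x⌋<n) ιn≤x))
  ... | tri≈ _ ⌊x⌋≡n _ = ⌊x⌋≡n
  ... | tri> _ _ n<⌊x⌋ = ⊥-elim (ι[1+n]≰x (≤-trans (ι-mono n<⌊x⌋) (floor-≤ x 0≤x)))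

  ⌊ι⌋ : ∀ n → ⌊ ι n ⌋ ≡ n
  ⌊ι⌋ n = ⌊⌋-unique (ι-nonneg n) ≤-refl
    (1≰0 ∘ ≤-resp-≈ [1+ιn]-ιn≈1 (-‿inverseʳ (ι n)) ∘ +-mono-≤ (- ι n))
    where
    [1+ιn]-ιn≈1 : 1# + ι n - ι n ≈ 1#
    [1+ιn]-ιn≈1 = trans (+-assoc 1# (ι n) (- ι n))
                    (trans (+-congˡ (-‿inverseʳ (ι n))) (+-identityʳ 1#))

  frac-ι : ∀ n → frac (ι n) ≈ 0#
  frac-ι n = trans (+-congˡ (-‿cong (reflexive (≡.cong ι (⌊ι⌋ n))))) (-‿inverseʳ (ι n))

  ι[m+m]*half≈ιm : ∀ m → ι (m ℕ.+ m) * half ≈ ι m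
  ι[m+m]*half≈ιm m = trans (*-congʳ (ι-+ m m)) ([x+x]*half≈x (ι m))

  ⌊x*half⌋≡m : ∀ {x m} → 0# ≤ x →
    m ℕ.+ m ℕ.≤ ⌊ x ⌋ → ⌊ x ⌋ ℕ.≤ suc (m ℕ.+ m) → ⌊ x * half ⌋ ≡ m
  ⌊x*half⌋≡m {x} {m} 0≤x 2m≤⌊x⌋ ⌊x⌋≤2m+1 =
    ⌊⌋-unique (*-nonneg 0≤x half-nonneg) ιm≤x*half ι[1+m]≰x*half
    where
    ιm≤x*half : ι m ≤ (x * half)
    ιm≤x*half = ≤-resp-≈ (ι[m+m]*half≈ιm m) refl
      (*-monoˡ-≤-nonneg half-nonneg (≤-trans (ι-mono 2m≤⌊x⌋) (floor-≤ x 0≤x)))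
    1+⌊x⌋≤[1+m]+[1+m] : suc ⌊ x ⌋ ℕ.≤ suc m ℕ.+ suc m
    1+⌊x⌋≤[1+m]+[1+m] =
      ℕ.s≤s (≡.subst (⌊ x ⌋ ℕ.≤_) (≡.sym (ℕ.+-suc m m)) ⌊x⌋≤2m+1)
    ι[1+m]≰x*half : ¬ (ι (suc m) ≤ (x * half))
    ι[1+m]≰x*half ι[1+m]≤x*half = ι[1+⌊x⌋]≰x x 0≤x
      (≤-trans (ι-mono 1+⌊x⌋≤[1+m]+[1+m])
        (≤-resp-≈ (sym (ι-+ (suc m) (suc m))) (x*half+x*half≈x x)
          (+-mono₂-≤ ι[1+m]≤x*half ι[1+m]≤x*half)))

module RoundingExpectation {c ℓ ℓ'} (F : OrderedFieldWithFloor c ℓ ℓ') where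
  open OrderedFieldWithFloor F
  open Extension F
  open OrderedFieldProperties F
  open CommutativeRingLemmas cring
  open import Algebra.Properties.Ring (CommutativeRing.ring cring) using (x[y-z]≈xy-xz; [y-z]x≈yx-zx)
  open import Algebra.Properties.AbelianGroup +-abelianGroup using (⁻¹-∙-comm)
  open import Algebra.Properties.Group +-group using (ε⁻¹≈ε)
  open import Algebra.Solver.Ring.NaturalCoefficients.Default commutativeSemiring
    using (solve; _:=_; _:+_; _:*_)
  open import Relation.Binary.Reasoning.Setoid setoid

  expBern : Carrier → ℕ → (ℕ → Carrier) → Carrier
  expBern q k h = q * h (suc k) + (1# - q) * h k

  expRound : Carrier → (ℕ → Carrier) → Carrier
  expRound x = expBern (frac x) ⌊ x ⌋

  expBern-congˡ : ∀ {q q′} k h → q ≈ q′ → expBern q k h ≈ expBern q′ k h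
  expBern-congˡ k h q≈q′ = +-cong (*-congʳ q≈q′) (*-congʳ (+-congˡ (-‿cong q≈q′)))

  expBern-congʳ : ∀ q k {h h′} → (∀ v → h v ≈ h′ v) → expBern q k h ≈ expBern q k h′
  expBern-congʳ q k h≈h′ = +-cong (*-congˡ (h≈h′ (suc k))) (*-congˡ (h≈h′ k))

  expRound-congʳ : ∀ x {h h′} → (∀ v → h v ≈ h′ v) → expRound x h ≈ expRound x h′
  expRound-congʳ x = expBern-congʳ (frac x) ⌊ x ⌋

  expRound-floor : ∀ {x k} h → ⌊ x ⌋ ≡ k → expRound x h ≈ expBern (frac x) k h
  expRound-floor h ≡.refl = refl

  expBern-0 : ∀ k h → expBern 0# k h ≈ h k
  expBern-0 k h = begin
    0# * h (suc k) + (1# - 0#) * h k ≈⟨ +-cong (zeroˡ _) (*-congʳ (+-congˡ ε⁻¹≈ε)) ⟩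
    0# + (1# + 0#) * h k             ≈⟨ +-identityˡ _ ⟩
    (1# + 0#) * h k                  ≈⟨ *-congʳ (+-identityʳ 1#) ⟩
    1# * h k                         ≈⟨ *-identityˡ _ ⟩
    h k                              ∎

  expBern-1 : ∀ k h → expBern 1# k h ≈ h (suc k)
  expBern-1 k h = begin
    1# * h (suc k) + (1# - 1#) * h k ≈⟨ +-cong (*-identityˡ _) (*-congʳ (-‿inverseʳ 1#)) ⟩
    h (suc k) + 0# * h k             ≈⟨ +-congˡ (zeroˡ _) ⟩
    h (suc k) + 0#                   ≈⟨ +-identityʳ _ ⟩
    h (suc k)                        ∎

  expBern-linear : ∀ q k a b f g →
    expBern q k (λ v → a * f v + b * g v) ≈ a * expBern q k f + b * expBern q k g
  expBern-linear q k a b f g =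
    solve 8 (λ q q̄ a b x₁ x₀ y₁ y₀ →
                q :* (a :* x₁ :+ b :* y₁) :+ q̄ :* (a :* x₀ :+ b :* y₀)
             := a :* (q :* x₁ :+ q̄ :* x₀) :+ b :* (q :* y₁ :+ q̄ :* y₀))
          refl q (1# - q) a b (f (suc k)) (f k) (g (suc k)) (g k)

  expBern-mix : ∀ q r r′ k h →
    q * expBern r k h + (1# - q) * expBern r′ k h ≈ expBern (q * r + (1# - q) * r′) k h
  expBern-mix q r r′ k h = begin
    q * expBern r k h + (1# - q) * expBern r′ k h
      ≈⟨ solve 8 (λ q q̄ r r̄ r′ r̄′ a b →
                    q :* (r :* a :+ r̄ :* b) :+ q̄ :* (r′ :* a :+ r̄′ :* b)
                 := (q :* r :+ q̄ :* r′) :* a :+ (q :* r̄ :+ q̄ :* r̄′) :* b)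
               refl q (1# - q) r (1# - r) r′ (1# - r′) (h (suc k)) (h k) ⟩
    (q * r + (1# - q) * r′) * h (suc k) + (q * (1# - r) + (1# - q) * (1# - r′)) * h k
      ≈⟨ +-congˡ (*-congʳ complement) ⟩
    expBern (q * r + (1# - q) * r′) k h ∎
    where
    complement : q * (1# - r) + (1# - q) * (1# - r′) ≈ 1# - (q * r + (1# - q) * r′)
    complement = begin
      q * (1# - r) + (1# - q) * (1# - r′)
        ≈⟨ +-cong (x[y-z]≈xy-xz q 1# r) (x[y-z]≈xy-xz (1# - q) 1# r′) ⟩
      (q * 1# - q * r) + ((1# - q) * 1# - (1# - q) * r′)
        ≈⟨ [x-y]+[z-w]≈[x+z]-[y+w] _ _ _ _ ⟩
      (q * 1# + (1# - q) * 1#) - (q * r + (1# - q) * r′)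
        ≈⟨ +-congʳ (trans (+-cong (*-identityʳ q) (*-identityʳ (1# - q))) (x+[y-x]≈y q 1#)) ⟩
      1# - (q * r + (1# - q) * r′) ∎

  expRound-half-even : ∀ {x m} h → 0# ≤ x → ⌊ x ⌋ ≡ m ℕ.+ m →
    expRound (x * half) h ≈ expBern (frac x * half) m h
  expRound-half-even {x} {m} h 0≤x ⌊x⌋≡m+m =
    trans (expRound-floor h ⌊x/2⌋≡m) (expBern-congˡ m h frac[x*half]≈)
    where
    ⌊x/2⌋≡m : ⌊ x * half ⌋ ≡ m
    ⌊x/2⌋≡m = ⌊x*half⌋≡m 0≤x (ℕ.≤-reflexive (≡.sym ⌊x⌋≡m+m))
                (ℕ.≤-trans (ℕ.≤-reflexive ⌊x⌋≡m+m) (ℕ.n≤1+n _))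
    frac[x*half]≈ : frac (x * half) ≈ frac x * half
    frac[x*half]≈ = begin
      x * half - ι ⌊ x * half ⌋
        ≈⟨ +-congˡ (-‿cong (reflexive (≡.cong ι ⌊x/2⌋≡m))) ⟩
      x * half - ι m
        ≈⟨ +-congˡ (-‿cong (ι[m+m]*half≈ιm m)) ⟨
      x * half - ι (m ℕ.+ m) * half
        ≈⟨ +-congˡ (-‿cong (*-congʳ (reflexive (≡.cong ι ⌊x⌋≡m+m)))) ⟨
      x * half - ι ⌊ x ⌋ * half
        ≈⟨ [y-z]x≈yx-zx half x (ι ⌊ x ⌋) ⟨
      frac x * half ∎

  expRound-half-odd : ∀ {x m} h → 0# ≤ x → ⌊ x ⌋ ≡ suc (m ℕ.+ m) →
    expRound (x * half) h ≈ expBern (half + frac x * half) m h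
  expRound-half-odd {x} {m} h 0≤x ⌊x⌋≡1+m+m =
    trans (expRound-floor h ⌊x/2⌋≡m) (expBern-congˡ m h frac[x*half]≈)
    where
    ⌊x/2⌋≡m : ⌊ x * half ⌋ ≡ m
    ⌊x/2⌋≡m = ⌊x*half⌋≡m 0≤x
      (ℕ.≤-trans (ℕ.n≤1+n _) (ℕ.≤-reflexive (≡.sym ⌊x⌋≡1+m+m)))
      (ℕ.≤-reflexive ⌊x⌋≡1+m+m)
    ι⌊x⌋*half≈ : ι ⌊ x ⌋ * half ≈ half + ι m
    ι⌊x⌋*half≈ = begin
      ι ⌊ x ⌋ * half                 ≈⟨ *-congʳ (reflexive (≡.cong ι ⌊x⌋≡1+m+m)) ⟩
      (1# + ι (m ℕ.+ m)) * half      ≈⟨ distribʳ half 1# (ι (m ℕ.+ m)) ⟩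
      1# * half + ι (m ℕ.+ m) * half ≈⟨ +-cong (*-identityˡ half) (ι[m+m]*half≈ιm m) ⟩
      half + ι m                     ∎
    frac[x*half]≈ : frac (x * half) ≈ half + frac x * half
    frac[x*half]≈ = begin
      x * half - ι ⌊ x * half ⌋
        ≈⟨ +-congˡ (-‿cong (reflexive (≡.cong ι ⌊x/2⌋≡m))) ⟩
      x * half - ι m
        ≈⟨ x+[y-x]≈y half _ ⟨
      half + ((x * half - ι m) - half)
        ≈⟨ +-congˡ (+-assoc (x * half) (- ι m) (- half)) ⟩
      half + (x * half + (- ι m - half))
        ≈⟨ +-congˡ (+-congˡ (trans (⁻¹-∙-comm (ι m) half) (-‿cong (+-comm _ _)))) ⟩
      half + (x * half - (half + ι m))
        ≈⟨ +-congˡ (+-congˡ (-‿cong ι⌊x⌋*half≈)) ⟨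
      half + (x * half - ι ⌊ x ⌋ * half)
        ≈⟨ +-congˡ ([y-z]x≈yx-zx half x (ι ⌊ x ⌋)) ⟨
      half + frac x * half ∎

  expRound-ι-even : ∀ m h → expRound (ι (m ℕ.+ m) * half) h ≈ expBern 0# m h
  expRound-ι-even m h = trans (expRound-half-even h (ι-nonneg (m ℕ.+ m)) (⌊ι⌋ (m ℕ.+ m)))
    (expBern-congˡ m h (trans (*-congʳ (frac-ι (m ℕ.+ m))) (zeroˡ half)))

  expRound-ι-odd : ∀ m h → expRound (ι (suc (m ℕ.+ m)) * half) h ≈ expBern half m h
  expRound-ι-odd m h =
    trans (expRound-half-odd h (ι-nonneg (suc (m ℕ.+ m))) (⌊ι⌋ (suc (m ℕ.+ m))))
    (expBern-congˡ m h (trans (+-congˡ (trans (*-congʳ (frac-ι (suc (m ℕ.+ m)))) (zeroˡ half)))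
                              (+-identityʳ half)))

  expRound-halve : ∀ {x} h → 0# ≤ x →
    expRound x (λ v → expRound (ι v * half) h) ≈ expRound (x * half) h
  expRound-halve {x} h 0≤x with even-or-odd ⌊ x ⌋
  ... | inj₁ (m , ⌊x⌋≡m+m) = begin
    expRound x g
      ≈⟨ expRound-floor g ⌊x⌋≡m+m ⟩
    frac x * g (suc (m ℕ.+ m)) + (1# - frac x) * g (m ℕ.+ m)
      ≈⟨ +-cong (*-congˡ (expRound-ι-odd m h)) (*-congˡ (expRound-ι-even m h)) ⟩
    frac x * expBern half m h + (1# - frac x) * expBern 0# m h
      ≈⟨ expBern-mix (frac x) half 0# m h ⟩
    expBern (frac x * half + (1# - frac x) * 0#) m h
      ≈⟨ expBern-congˡ m h (trans (+-congˡ (zeroʳ _)) (+-identityʳ _)) ⟩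
    expBern (frac x * half) m h
      ≈⟨ expRound-half-even h 0≤x ⌊x⌋≡m+m ⟨
    expRound (x * half) h ∎
    where
    g : ℕ → Carrier
    g v = expRound (ι v * half) h
  ... | inj₂ (m , ⌊x⌋≡1+m+m) = begin
    expRound x g
      ≈⟨ expRound-floor g ⌊x⌋≡1+m+m ⟩
    frac x * g (suc (suc (m ℕ.+ m))) + (1# - frac x) * g (suc (m ℕ.+ m))
      ≈⟨ +-cong (*-congˡ g[2+m+m]≈) (*-congˡ (expRound-ι-odd m h)) ⟩
    frac x * expBern 1# m h + (1# - frac x) * expBern half m h
      ≈⟨ expBern-mix (frac x) 1# half m h ⟩
    expBern (frac x * 1# + (1# - frac x) * half) m h
      ≈⟨ expBern-congˡ m h (mixed-parameter (frac x)) ⟩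
    expBern (half + frac x * half) m h
      ≈⟨ expRound-half-odd h 0≤x ⌊x⌋≡1+m+m ⟨
    expRound (x * half) h ∎
    where
    g : ℕ → Carrier
    g v = expRound (ι v * half) h
    g[2+m+m]≈ : g (suc (suc (m ℕ.+ m))) ≈ expBern 1# m h
    g[2+m+m]≈ = begin
      g (suc (suc (m ℕ.+ m))) ≡⟨ ≡.cong (g ∘ suc) (ℕ.+-suc m m) ⟨
      g (suc m ℕ.+ suc m)     ≈⟨ expRound-ι-even (suc m) h ⟩
      expBern 0# (suc m) h    ≈⟨ expBern-0 (suc m) h ⟩
      h (suc m)               ≈⟨ expBern-1 m h ⟨
      expBern 1# m h          ∎
    mixed-parameter : ∀ q → q * 1# + (1# - q) * half ≈ half + q * half
    mixed-parameter q = begin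
      q * 1# + (1# - q) * half
        ≈⟨ +-cong (*-identityʳ q) ([y-z]x≈yx-zx half 1# q) ⟩
      q + (1# * half - q * half)
        ≈⟨ +-cong (x*half+x*half≈x q) (+-congʳ (sym (*-identityˡ half))) ⟨
      (q * half + q * half) + (half - q * half)
        ≈⟨ +-assoc _ _ _ ⟩
      q * half + (q * half + (half - q * half))
        ≈⟨ +-congˡ (x+[y-x]≈y (q * half) half) ⟩
      q * half + half
        ≈⟨ +-comm _ _ ⟩
      half + q * half ∎

  iterExp : (n : ℕ) → (Fin n → Carrier) → ((Fin n → ℕ) → Carrier) → Carrier
  iterExp zero    d g = g []
  iterExp (suc n) d g = expRound (head d) (λ v → iterExp n (tail d) (g ∘ (v ∷_)))

  iterExp-resp-≗ : ∀ n {d d′} g → d ≗ d′ → iterExp n d g ≈ iterExp n d′ g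
  iterExp-resp-≗ zero    g d≗d′ = refl
  iterExp-resp-≗ (suc n) {d} {d′} g d≗d′ = trans
    (expRound-congʳ (head d) (λ v → iterExp-resp-≗ n (g ∘ (v ∷_)) (d≗d′ ∘ suc)))
    (reflexive (≡.cong (λ x → expRound x h) (d≗d′ zero)))
    where
    h : ℕ → Carrier
    h v = iterExp n (tail d′) (g ∘ (v ∷_))

  iterExp-linear : ∀ n d a b f g →
    iterExp n d (λ X → a * f X + b * g X) ≈ a * iterExp n d f + b * iterExp n d g
  iterExp-linear zero    d a b f g = refl
  iterExp-linear (suc n) d a b f g = trans
    (expRound-congʳ (head d) (λ v → iterExp-linear n (tail d) a b (f ∘ (v ∷_)) (g ∘ (v ∷_))))
    (expBern-linear (frac (head d)) ⌊ head d ⌋ a b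
      (λ v → iterExp n (tail d) (f ∘ (v ∷_))) (λ v → iterExp n (tail d) (g ∘ (v ∷_))))

  iterExp-expRound-comm : ∀ n d x (H : ℕ → (Fin n → ℕ) → Carrier) →
    iterExp n d (λ X → expRound x (λ v → H v X)) ≈ expRound x (λ v → iterExp n d (H v))
  iterExp-expRound-comm n d x H =
    iterExp-linear n d (frac x) (1# - frac x) (H (suc ⌊ x ⌋)) (H ⌊ x ⌋)

  iterExp-compose : ∀ n {d d′} (κ : ℕ → Carrier) →
    (∀ i h → expRound (d i) (λ v → expRound (κ v) h) ≈ expRound (d′ i) h) →
    ∀ g → iterExp n d (λ X → iterExp n (κ ∘ X) g) ≈ iterExp n d′ g
  iterExp-compose zero    κ composeᵢ g = refl
  iterExp-compose (suc n) {d} {d′} κ composeᵢ g = begin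
    expRound (head d) (λ v → iterExp n (tail d) (λ X →
      expRound (κ v) (λ w → iterExp n (κ ∘ X) (g ∘ (w ∷_)))))
      ≈⟨ expRound-congʳ (head d) (λ v → iterExp-expRound-comm n (tail d) (κ v)
                                           (λ w X → iterExp n (κ ∘ X) (g ∘ (w ∷_)))) ⟩
    expRound (head d) (λ v → expRound (κ v) (λ w →
      iterExp n (tail d) (λ X → iterExp n (κ ∘ X) (g ∘ (w ∷_)))))
      ≈⟨ expRound-congʳ (head d) (λ v → expRound-congʳ (κ v) (λ w →
           iterExp-compose n κ (composeᵢ ∘ suc) (g ∘ (w ∷_)))) ⟩
    expRound (head d) (λ v → expRound (κ v) (λ w → iterExp n (tail d′) (g ∘ (w ∷_))))
      ≈⟨ composeᵢ zero (λ w → iterExp n (tail d′) (g ∘ (w ∷_))) ⟩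
    expRound (head d′) (λ w → iterExp n (tail d′) (g ∘ (w ∷_))) ∎

  Extensional : ∀ {n} → ((Fin n → ℕ) → Carrier) → Set ℓ
  Extensional g = ∀ {X Y} → X ≗ Y → g X ≈ g Y

  Extensional-∷ : ∀ {n} {g : (Fin (suc n) → ℕ) → Carrier} v →
    Extensional g → Extensional (λ X → g (v ∷ X))
  Extensional-∷ v g-ext {X} {Y} X≗Y =
    g-ext {v ∷ X} {v ∷ Y} λ { zero → ≡.refl ; (suc i) → X≗Y i }

  Exp-cong : ∀ {n} (d : Fin n → Carrier) {g g′} →
    (∀ X → g X ≈ g′ X) → Exp d g ≈ Exp d g′
  Exp-cong {n} d g≈g′ = sumSubsets-cong n (λ S → *-congˡ (g≈g′ _))

  Exp-suc : ∀ {n} (d : Fin (suc n) → Carrier) {g} → Extensional g →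
    Exp d g ≈ expRound (head d) (λ v → Exp (tail d) (g ∘ (v ∷_)))
  Exp-suc {n} d {g} g-ext = +-cong
    (branch (λ s → g-ext λ { zero → ℕ.+-comm ⌊ head d ⌋ 1 ; (suc i) → ≡.refl }))
    (branch (λ s → g-ext λ { zero → ℕ.+-identityʳ ⌊ head d ⌋ ; (suc i) → ≡.refl }))
    where
    branch : ∀ {p v} {Xs : (Fin n → Bool) → Fin (suc n) → ℕ} →
      (∀ s → g (Xs s) ≈ g (v ∷ roundUp (tail d) s)) →
      sumSubsets cring n (λ s → (p * prob (tail d) s) * g (Xs s))
        ≈ p * Exp (tail d) (g ∘ (v ∷_))
    branch {p} g≈ = sym (trans (*-distribˡ-sumSubsets n p _)
      (sumSubsets-cong n (λ s → sym (trans (*-congˡ (g≈ s)) (*-assoc p _ _)))))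

  Exp≈iterExp : ∀ n (d : Fin n → Carrier) {g} → Extensional g → Exp d g ≈ iterExp n d g
  Exp≈iterExp zero    d g-ext = trans (*-identityˡ _) (g-ext (λ ()))
  Exp≈iterExp (suc n) d g-ext = trans (Exp-suc d g-ext)
    (expRound-congʳ (head d) (λ v → Exp≈iterExp n (tail d) (Extensional-∷ v g-ext)))

lemma7 : ∀ {c ℓ ℓ'} (F : OrderedFieldWithFloor c ℓ ℓ') →
    let open OrderedFieldWithFloor F in
    let open Extension F in
    (L m : ℕ) (𝒜 : Fin m → Fin L → Bool) → Covers 𝒜 →
    (B : (Fin L → ℕ) → ℕ) → (∀ X → IsOptValue 𝒜 X (B X)) →
    (d : Fin L → Carrier) → (∀ i → 0# ≤ d i) →
    Bext B (λ i → d i * half) ≈ Exp d (λ X → Bext B (λ i → ι (X i) * half))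
lemma7 F L m 𝒜 _ B opt d 0≤d = begin
  Exp (λ i → d i * half) G
    ≈⟨ Exp≈iterExp L _ G-ext ⟩
  iterExp L (λ i → d i * half) G
    ≈⟨ iterExp-compose L κ composeᵢ G ⟨
  iterExp L d (λ X → iterExp L (κ ∘ X) G)
    ≈⟨ Exp≈iterExp L d iterExp-κ-ext ⟨
  Exp d (λ X → iterExp L (κ ∘ X) G)
    ≈⟨ Exp-cong d (λ X → Exp≈iterExp L (κ ∘ X) G-ext) ⟨
  Exp d (λ X → Exp (κ ∘ X) G) ∎
  where
  open OrderedFieldWithFloor F
  open Extension F
  open RoundingExpectation F
  open import Relation.Binary.Reasoning.Setoid setoid
  G : (Fin L → ℕ) → Carrier
  G X = ι (B X)
  G-ext : Extensional G
  G-ext X≗Y = reflexive (≡.cong ι (IsOptValue-unique X≗Y (opt _) (opt _)))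
  κ : ℕ → Carrier
  κ v = ι v * half
  composeᵢ : ∀ i h → expRound (d i) (λ v → expRound (κ v) h) ≈ expRound (d i * half) h
  composeᵢ i h = expRound-halve h (0≤d i)
  iterExp-κ-ext : Extensional (λ X → iterExp L (κ ∘ X) G)
  iterExp-κ-ext X≗Y = iterExp-resp-≗ L G (≡.cong κ ∘ X≗Y)
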